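{- Let $k$, $m$, $n$, $p$ and $r$ be positive integers and let $[\lambda_1,\ldots,\lambda_m]$ be a composition of $n$. Put $a_0=0$ and $a_i=\lambda_1+\cdots+\lambda_i$. Then $$w_{p,r}(n,n-k)=\sum_{k_1+\cdots+k_m=k}\prod_{i=1}^{m}w_{p,a_{i-1}p+r}(\lambda_i,\lambda_i-k_i),$$ the sum being over all $m$-tuples of nonnegative integers $(k_1,\ldots,k_m)$ with sum $k$.
   Context: For positive integers $p,r$ and an integer $N\ge0$, the $r$-Whitney numbers of the first kind $w_{p,r}(N,j)$, $0\le j\le N$, are defined by the polynomial identity in $x$: $p^N(x)_N=\sum_{j=0}^{N}w_{p,r}(N,j)(px+r)^j$, where $(x)_N=x(x-1)\cdots(x-N+1)$, $(x)_0=1$. Set $w_{p,r}(N,j)=0$ for $j<0$ or $j>N$. A composition of $n$ is a sequence of positive integers summing to $n$. -}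

module Defs where

open import Data.Nat as ℕ using (ℕ; zero; suc)
open import Data.Integer using (ℤ; +_; _+_; _*_; _-_; _^_; _<_)
open import Data.List using (List; []; _∷_; map; foldr; concatMap; upTo)
open import Data.Vec using (Vec; []; _∷_)
import Data.Vec as Vec
open import Data.Product using (_×_)
open import Relation.Binary.PropositionalEquality using (_≡_)

sumℤ : List ℤ → ℤ
sumℤ = foldr _+_ (+ 0)

falling : ℤ → ℕ → ℤ
falling x zero    = + 1
falling x (suc N) = falling x N * (x - + N)

-- The polynomial identity  p^N (x)_N = Σ_{j=0}^N w_{p,r}(N,j) (px+r)^j  in ℤ[x]
-- is expressed as equality of the two sides at every integer x
-- (equivalent, since a polynomial over ℤ with infinitely many roots is zero),
-- together with the convention w_{p,r}(N,j) = 0 for j < 0 or j > N.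
IsWhitney₁ : (ℕ → ℕ → ℕ → ℤ → ℤ) → Set
IsWhitney₁ w =
  (∀ p r N → 1 ℕ.≤ p → 1 ℕ.≤ r → (x : ℤ) →
     (+ p) ^ N * falling x N
       ≡ sumℤ (map (λ j → w p r N (+ j) * ((+ p) * x + + r) ^ j) (upTo (suc N))))
  × (∀ p r N j → 1 ℕ.≤ p → 1 ℕ.≤ r → j < + 0 → w p r N j ≡ + 0)
  × (∀ p r N j → 1 ℕ.≤ p → 1 ℕ.≤ r → + N < j → w p r N j ≡ + 0)

tuplesSum : (m k : ℕ) → List (Vec ℕ m)
tuplesSum zero zero    = [] ∷ []
tuplesSum zero (suc k) = []
tuplesSum (suc m) k =
  concatMap (λ i → map (i ∷_) (tuplesSum m (k ℕ.∸ i))) (upTo (suc k))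

AllPositive : ∀ {m} → Vec ℕ m → Set
AllPositive []       = Data.Unit.⊤ where import Data.Unit
AllPositive (x ∷ xs) = (1 ℕ.≤ x) × AllPositive xs

prefixSums : ∀ {m} → Vec ℕ m → Vec ℕ m
prefixSums []       = []
prefixSums (x ∷ xs) = 0 ∷ Vec.map (x ℕ.+_) (prefixSums xs)

whitneyProduct : (ℕ → ℕ → ℕ → ℤ → ℤ) → ℕ → ℕ → ∀ {m} → Vec ℕ m → Vec ℕ m → ℤ
whitneyProduct w p r λs ks =
  Vec.foldr (λ _ → ℤ) _*_ (+ 1)
    (Vec.zipWith (λ a lk → w p (a ℕ.* p ℕ.+ r) (Data.Product.proj₁ lk)
                              (+ Data.Product.proj₁ lk - + Data.Product.proj₂ lk))
       (prefixSums λs) (Vec.zip λs ks))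
  where import Data.Product

-- Put y = p x + r.  By definition p^N (x)_N = Σ_k w_{p,r}(N, N - k) y^(N - k), and since
-- p (x - l) + (l p + r) = p x + r, the splitting (x)_{l+N} = (x)_l (x - l)_N writes the
-- expansion of order l + N as the product of the expansions of orders l and N, the latter
-- with r replaced by l p + r.  Both sides are polynomials in y of degree ≤ l + N agreeing on
-- the infinite progression r, r + p, r + 2p, …, so their coefficients agree:
--   w_{p,r}(l + N, l + N - k) = Σ_i w_{p,r}(l, l - i) w_{p,lp+r}(N, N - k + i).
-- Induction on the number of parts of the composition gives the corollary.
module Submission where

open import Defs
open import Data.Nat as ℕ using (ℕ; zero; suc; _≤_; _<_; z≤n; s≤s; _∸_)
import Data.Nat.Properties as ℕₚ
open import Data.Integer as ℤ using (ℤ; +_; -[1+_]; _+_; _-_; _*_; _^_)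
import Data.Integer.Properties as ℤₚ
open import Data.Integer.Tactic.RingSolver using (solve-∀)
open import Data.Nat.Tactic.RingSolver using () renaming (solve-∀ to solve-∀ℕ)
open import Algebra.Properties.CommutativeSemigroup ℤₚ.*-commutativeSemigroup
  using (interchange)
open import Data.List using (List; []; _∷_; _++_; map; concatMap; upTo; applyUpTo)
import Data.List.Properties as Listₚ
open import Data.Vec using (Vec; []; _∷_; sum)
import Data.Vec as Vec
open import Data.Product using (_×_; proj₁; proj₂)
open import Data.Sum using (inj₁; inj₂)
open import Function using (_∘_)
open import Relation.Binary.PropositionalEquality
open import Relation.Nullary using (yes; no; contradiction)
open ≡-Reasoning

sumℤ-++ : ∀ xs ys → sumℤ (xs ++ ys) ≡ sumℤ xs + sumℤ ys
sumℤ-++ []       ys = sym (ℤₚ.+-identityˡ (sumℤ ys))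
sumℤ-++ (x ∷ xs) ys =
  trans (cong (λ s → x + s) (sumℤ-++ xs ys)) (sym (ℤₚ.+-assoc x (sumℤ xs) (sumℤ ys)))

sumℤ-concatMap : ∀ {A : Set} (F : A → List ℤ) xs →
                 sumℤ (concatMap F xs) ≡ sumℤ (map (sumℤ ∘ F) xs)
sumℤ-concatMap F []       = refl
sumℤ-concatMap F (x ∷ xs) =
  trans (sumℤ-++ (F x) (concatMap F xs)) (cong (λ s → sumℤ (F x) + s) (sumℤ-concatMap F xs))

sumℤ-map-*ˡ : ∀ c xs → sumℤ (map (c *_) xs) ≡ c * sumℤ xs
sumℤ-map-*ˡ c []       = sym (ℤₚ.*-zeroʳ c)
sumℤ-map-*ˡ c (x ∷ xs) =
  trans (cong (λ s → c * x + s) (sumℤ-map-*ˡ c xs)) (sym (ℤₚ.*-distribˡ-+ c x (sumℤ xs)))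

∑< : ℕ → (ℕ → ℤ) → ℤ
∑< n f = sumℤ (applyUpTo f n)

∑<-cong : ∀ n {f g} → (∀ i → i < n → f i ≡ g i) → ∑< n f ≡ ∑< n g
∑<-cong zero    eq = refl
∑<-cong (suc n) eq = cong₂ _+_ (eq 0 (s≤s z≤n)) (∑<-cong n (λ i i<n → eq (suc i) (s≤s i<n)))

∑<-zero : ∀ n {f} → (∀ i → i < n → f i ≡ + 0) → ∑< n f ≡ + 0
∑<-zero zero    eq = refl
∑<-zero (suc n) eq = cong₂ _+_ (eq 0 (s≤s z≤n)) (∑<-zero n (λ i i<n → eq (suc i) (s≤s i<n)))

∑<-*ˡ : ∀ c n f → ∑< n (λ i → c * f i) ≡ c * ∑< n f
∑<-*ˡ c n f =
  trans (cong sumℤ (sym (Listₚ.map-applyUpTo f (c *_) n))) (sumℤ-map-*ˡ c (applyUpTo f n))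

-- Coefficients are indexed from the leading one:
-- horner n c y = c 0 * y ^ (n ∸ 1) + c 1 * y ^ (n ∸ 2) + ⋯ + c (n ∸ 1).
horner : ℕ → (ℕ → ℤ) → ℤ → ℤ
horner zero    c y = + 0
horner (suc n) c y = y * horner n c y + c n

horner-cong : ∀ n {c d} y → (∀ k → k < n → c k ≡ d k) → horner n c y ≡ horner n d y
horner-cong zero    y eq = refl
horner-cong (suc n) y eq =
  cong₂ (λ h t → y * h + t) (horner-cong n y (λ k k<n → eq k (ℕₚ.m<n⇒m<1+n k<n))) (eq n ℕₚ.≤-refl)

horner-+ : ∀ n c d y → horner n (λ k → c k + d k) y ≡ horner n c y + horner n d y
horner-+ zero    c d y = refl
horner-+ (suc n) c d y = begin
  y * horner n (λ k → c k + d k) y + (c n + d n)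
    ≡⟨ cong (λ h → y * h + (c n + d n)) (horner-+ n c d y) ⟩
  y * (horner n c y + horner n d y) + (c n + d n)
    ≡⟨ rearrange y (horner n c y) (horner n d y) (c n) (d n) ⟩
  (y * horner n c y + c n) + (y * horner n d y + d n) ∎
  where
  rearrange : ∀ y a b s t → y * (a + b) + (s + t) ≡ (y * a + s) + (y * b + t)
  rearrange = solve-∀

horner-- : ∀ n c d y → horner n (λ k → c k - d k) y ≡ horner n c y - horner n d y
horner-- zero    c d y = refl
horner-- (suc n) c d y = begin
  y * horner n (λ k → c k - d k) y + (c n - d n)
    ≡⟨ cong (λ h → y * h + (c n - d n)) (horner-- n c d y) ⟩
  y * (horner n c y - horner n d y) + (c n - d n)
    ≡⟨ rearrange y (horner n c y) (horner n d y) (c n) (d n) ⟩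
  (y * horner n c y + c n) - (y * horner n d y + d n) ∎
  where
  rearrange : ∀ y a b s t → y * (a - b) + (s - t) ≡ (y * a + s) - (y * b + t)
  rearrange = solve-∀

horner-*ˡ : ∀ a n c y → horner n (λ k → a * c k) y ≡ a * horner n c y
horner-*ˡ a zero    c y = sym (ℤₚ.*-zeroʳ a)
horner-*ˡ a (suc n) c y = begin
  y * horner n (λ k → a * c k) y + a * c n ≡⟨ cong (λ h → y * h + a * c n) (horner-*ˡ a n c y) ⟩
  y * (a * horner n c y) + a * c n         ≡⟨ rearrange y a (horner n c y) (c n) ⟩
  a * (y * horner n c y + c n)             ∎
  where
  rearrange : ∀ y a h t → y * (a * h) + a * t ≡ a * (y * h + t)
  rearrange = solve-∀

horner-leading : ∀ n c y → horner (suc n) c y ≡ c 0 * y ^ n + horner n (c ∘ suc) y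
horner-leading zero    c y = constant y (c 0)
  where
  constant : ∀ y a → y * + 0 + a ≡ a * + 1 + + 0
  constant = solve-∀
horner-leading (suc n) c y = begin
  y * horner (suc n) c y + c (suc n)
    ≡⟨ cong (λ h → y * h + c (suc n)) (horner-leading n c y) ⟩
  y * (c 0 * y ^ n + horner n (c ∘ suc) y) + c (suc n)
    ≡⟨ rearrange y (c 0) (y ^ n) (horner n (c ∘ suc) y) (c (suc n)) ⟩
  c 0 * (y * y ^ n) + (y * horner n (c ∘ suc) y + c (suc n)) ∎
  where
  rearrange : ∀ y a t h b → y * (a * t + h) + b ≡ a * (y * t) + (y * h + b)
  rearrange = solve-∀

horner-trailing-zeros : ∀ m n c y → (∀ k → n ≤ k → c k ≡ + 0) →
  horner (m ℕ.+ n) c y ≡ y ^ m * horner n c y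
horner-trailing-zeros zero    n c y zeros = sym (ℤₚ.*-identityˡ (horner n c y))
horner-trailing-zeros (suc m) n c y zeros = begin
  y * horner (m ℕ.+ n) c y + c (m ℕ.+ n)
    ≡⟨ cong₂ (λ h t → y * h + t) (horner-trailing-zeros m n c y zeros) (zeros (m ℕ.+ n) (ℕₚ.m≤n+m n m)) ⟩
  y * (y ^ m * horner n c y) + + 0
    ≡⟨ trans (ℤₚ.+-identityʳ _) (sym (ℤₚ.*-assoc y (y ^ m) (horner n c y))) ⟩
  y * y ^ m * horner n c y ∎

horner-division : ∀ n c y q →
  horner (suc n) c y ≡ horner (suc n) c q + (y - q) * horner n (λ j → horner (suc j) c q) y
horner-division zero    c y q = rearrange y q (c 0)
  where
  rearrange : ∀ y q a → y * + 0 + a ≡ (q * + 0 + a) + (y - q) * + 0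
  rearrange = solve-∀
horner-division (suc n) c y q = begin
  y * horner (suc n) c y + c (suc n)
    ≡⟨ cong (λ h → y * h + c (suc n)) (horner-division n c y q) ⟩
  y * (horner (suc n) c q + (y - q) * quotient) + c (suc n)
    ≡⟨ rearrange y q (horner (suc n) c q) quotient (c (suc n)) ⟩
  (q * horner (suc n) c q + c (suc n)) + (y - q) * (y * quotient + horner (suc n) c q) ∎
  where
  quotient : ℤ
  quotient = horner n (λ j → horner (suc j) c q) y
  rearrange : ∀ y q r s t → y * (r + (y - q) * s) + t ≡ (q * r + t) + (y - q) * (y * s + r)
  rearrange = solve-∀

horner-partials≡0⇒coefficients≡0 : ∀ n c q →
  (∀ k → k < n → horner (suc k) c q ≡ + 0) → ∀ k → k < n → c k ≡ + 0
horner-partials≡0⇒coefficients≡0 n c q partials k k<n = begin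
  c k                    ≡⟨ sym (ℤₚ.+-identityˡ (c k)) ⟩
  + 0 + c k              ≡⟨ cong (_+ c k) (sym (trans (cong (q *_) (previous k k<n)) (ℤₚ.*-zeroʳ q))) ⟩
  q * horner k c q + c k ≡⟨ partials k k<n ⟩
  + 0                    ∎
  where
  previous : ∀ k → k < n → horner k c q ≡ + 0
  previous zero    _   = refl
  previous (suc k) k<n = partials k (ℕₚ.<-trans (ℕₚ.n<1+n k) k<n)

*-cancelˡ-≡0 : ∀ a {b} → a ≢ + 0 → a * b ≡ + 0 → b ≡ + 0
*-cancelˡ-≡0 a a≢0 ab≡0 with ℤₚ.i*j≡0⇒i≡0∨j≡0 a ab≡0
... | inj₁ a≡0 = contradiction a≡0 a≢0
... | inj₂ b≡0 = b≡0

-- Dividing by y - q leaves a quotient of smaller degree that vanishes on q + d, q + 2d, ….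
progression-roots⇒coefficients≡0 : ∀ {d} → d ≢ + 0 → ∀ n c q →
  (∀ i → horner n c (d * + i + q) ≡ + 0) → ∀ k → k < n → c k ≡ + 0
progression-roots⇒coefficients≡0 d≢0 zero c q roots k ()
progression-roots⇒coefficients≡0 {d} d≢0 (suc n) c q roots =
  horner-partials≡0⇒coefficients≡0 (suc n) c q partials
  where
  quotient : ℕ → ℤ
  quotient j = horner (suc j) c q
  remainder : horner (suc n) c q ≡ + 0
  remainder = subst (λ y → horner (suc n) c y ≡ + 0)
                    (trans (cong (_+ q) (ℤₚ.*-zeroʳ d)) (ℤₚ.+-identityˡ q)) (roots 0)
  quotient-roots : ∀ i → horner n quotient (d * + i + (d + q)) ≡ + 0
  quotient-roots i = subst (λ z → horner n quotient z ≡ + 0) (regroup d (+ i) q)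
                           (*-cancelˡ-≡0 (+ suc i) (λ ()) (*-cancelˡ-≡0 d d≢0 factored))
    where
    y : ℤ
    y = d * + suc i + q
    Q : ℤ
    Q = horner n quotient y
    regroup : ∀ d i q → d * (+ 1 + i) + q ≡ d * i + (d + q)
    regroup = solve-∀
    unshift : ∀ d i q Q → d * ((+ 1 + i) * Q) ≡ ((d * (+ 1 + i) + q) - q) * Q
    unshift = solve-∀
    factored : d * (+ suc i * Q) ≡ + 0
    factored = begin
      d * (+ suc i * Q)                ≡⟨ unshift d (+ i) q Q ⟩
      (y - q) * Q                      ≡⟨ sym (ℤₚ.+-identityˡ _) ⟩
      + 0 + (y - q) * Q                ≡⟨ cong (λ s → s + (y - q) * Q) (sym remainder) ⟩
      horner (suc n) c q + (y - q) * Q ≡⟨ sym (horner-division n c y q) ⟩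
      horner (suc n) c y               ≡⟨ roots (suc i) ⟩
      + 0                              ∎
  partials : ∀ k → k < suc n → horner (suc k) c q ≡ + 0
  partials k k<1+n with ℕₚ.m≤n⇒m<n∨m≡n (ℕₚ.≤-pred k<1+n)
  ... | inj₁ k<n  = progression-roots⇒coefficients≡0 d≢0 n quotient (d + q) quotient-roots k k<n
  ... | inj₂ refl = remainder

VanishesAbove : ℕ → (ℕ → ℤ) → Set
VanishesAbove n c = ∀ k → n < k → c k ≡ + 0

horner-coefficients-unique : ∀ {d} → d ≢ + 0 → ∀ N {c c′} q →
  VanishesAbove N c → VanishesAbove N c′ →
  (∀ i → horner (suc N) c (d * + i + q) ≡ horner (suc N) c′ (d * + i + q)) →
  ∀ k → c k ≡ c′ k
horner-coefficients-unique {d} d≢0 N {c} {c′} q c-vanishes c′-vanishes agree k with k ℕ.≤? N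
... | yes k≤N = ℤₚ.i-j≡0⇒i≡j (c k) (c′ k)
  (progression-roots⇒coefficients≡0 d≢0 (suc N) (λ j → c j - c′ j) q difference-roots k (s≤s k≤N))
  where
  difference-roots : ∀ i → horner (suc N) (λ j → c j - c′ j) (d * + i + q) ≡ + 0
  difference-roots i = trans (horner-- (suc N) c c′ (d * + i + q)) (ℤₚ.i≡j⇒i-j≡0 (agree i))
... | no k≰N = trans (c-vanishes k (ℕₚ.≰⇒> k≰N)) (sym (c′-vanishes k (ℕₚ.≰⇒> k≰N)))

∑<-powers≡horner : ∀ n (g : ℕ → ℤ) y → ∑< n (λ j → g j * y ^ j) ≡ horner n (λ k → g (n ∸ suc k)) y
∑<-powers≡horner zero    g y = refl
∑<-powers≡horner (suc n) g y = begin
  g 0 * + 1 + ∑< n (λ j → g (suc j) * (y * y ^ j))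
    ≡⟨ cong (λ s → g 0 * + 1 + s) (∑<-cong n (λ j _ → swap (g (suc j)) y (y ^ j))) ⟩
  g 0 * + 1 + ∑< n (λ j → y * (g (suc j) * y ^ j))
    ≡⟨ cong (λ s → g 0 * + 1 + s) (∑<-*ˡ y n (λ j → g (suc j) * y ^ j)) ⟩
  g 0 * + 1 + y * ∑< n (λ j → g (suc j) * y ^ j)
    ≡⟨ cong (λ s → g 0 * + 1 + y * s) (∑<-powers≡horner n (g ∘ suc) y) ⟩
  g 0 * + 1 + y * horner n (λ k → g (suc (n ∸ suc k))) y
    ≡⟨ rearrange (g 0) y (horner n (λ k → g (suc (n ∸ suc k))) y) ⟩
  y * horner n (λ k → g (suc (n ∸ suc k))) y + g 0
    ≡⟨ cong₂ (λ h t → y * h + g t)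
             (horner-cong n y (λ k k<n → cong g (sym (ℕₚ.+-∸-assoc 1 k<n))))
             (sym (ℕₚ.n∸n≡0 n)) ⟩
  y * horner n (λ k → g (n ∸ k)) y + g (n ∸ n) ∎
  where
  swap : ∀ a y t → a * (y * t) ≡ y * (a * t)
  swap = solve-∀
  rearrange : ∀ a y h → a * + 1 + y * h ≡ y * h + a
  rearrange = solve-∀

infixl 7 _⋆_
_⋆_ : (ℕ → ℤ) → (ℕ → ℤ) → ℕ → ℤ
(f ⋆ g) k = ∑< (suc k) (λ i → f i * g (k ∸ i))

⋆-congʳ : ∀ f {g h} → (∀ k → g k ≡ h k) → ∀ k → (f ⋆ g) k ≡ (f ⋆ h) k
⋆-congʳ f g≗h k = ∑<-cong (suc k) (λ i _ → cong (f i *_) (g≗h (k ∸ i)))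

⋆-vanishesAbove : ∀ {a b f g} → VanishesAbove a f → VanishesAbove b g →
  VanishesAbove (a ℕ.+ b) (f ⋆ g)
⋆-vanishesAbove {a} {b} {f} {g} f-vanishes g-vanishes k a+b<k = ∑<-zero (suc k) term-vanishes
  where
  term-vanishes : ∀ i → i < suc k → f i * g (k ∸ i) ≡ + 0
  term-vanishes i _ with a ℕ.<? i
  ... | yes a<i = trans (cong (_* g (k ∸ i)) (f-vanishes i a<i)) (ℤₚ.*-zeroˡ (g (k ∸ i)))
  ... | no a≮i  = trans (cong (f i *_) (g-vanishes (k ∸ i) b<k∸i)) (ℤₚ.*-zeroʳ (f i))
    where
    i+b<k : i ℕ.+ b < k
    i+b<k = ℕₚ.≤-<-trans (ℕₚ.+-monoˡ-≤ b (ℕₚ.≮⇒≥ a≮i)) a+b<k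
    b<k∸i : b < k ∸ i
    b<k∸i = ℕₚ.m+n≤o⇒m≤o∸n (suc b) (subst (_< k) (ℕₚ.+-comm i b) i+b<k)

⋆-constˡ : ∀ {f} g → VanishesAbove 0 f → ∀ k → (f ⋆ g) k ≡ f 0 * g k
⋆-constˡ {f} g f-vanishes zero    = ℤₚ.+-identityʳ (f 0 * g 0)
⋆-constˡ {f} g f-vanishes (suc k) =
  trans (cong (λ s → f 0 * g (suc k) + s) (∑<-zero (suc k) tail-vanishes))
        (ℤₚ.+-identityʳ (f 0 * g (suc k)))
  where
  tail-vanishes : ∀ i → i < suc k → f (suc i) * g (k ∸ i) ≡ + 0
  tail-vanishes i _ =
    trans (cong (_* g (k ∸ i)) (f-vanishes (suc i) (s≤s z≤n))) (ℤₚ.*-zeroˡ (g (k ∸ i)))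

horner-⋆ : ∀ a b {f g} y → VanishesAbove a f → VanishesAbove b g →
  horner (suc a) f y * horner (suc b) g y ≡ horner (suc (a ℕ.+ b)) (f ⋆ g) y
horner-⋆ zero b {f} {g} y f-vanishes g-vanishes = begin
  (y * + 0 + f 0) * horner (suc b) g y ≡⟨ cong (λ h → (h + f 0) * horner (suc b) g y) (ℤₚ.*-zeroʳ y) ⟩
  (+ 0 + f 0) * horner (suc b) g y     ≡⟨ cong (_* horner (suc b) g y) (ℤₚ.+-identityˡ (f 0)) ⟩
  f 0 * horner (suc b) g y             ≡⟨ sym (horner-*ˡ (f 0) (suc b) g y) ⟩
  horner (suc b) (λ k → f 0 * g k) y   ≡⟨ horner-cong (suc b) y (λ k _ → sym (⋆-constˡ g f-vanishes k)) ⟩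
  horner (suc b) (f ⋆ g) y             ∎
horner-⋆ (suc a) b {f} {g} y f-vanishes g-vanishes = begin
  horner (suc (suc a)) f y * G
    ≡⟨ cong (_* G) (horner-leading (suc a) f y) ⟩
  (f 0 * y ^ suc a + horner (suc a) (f ∘ suc) y) * G
    ≡⟨ ℤₚ.*-distribʳ-+ G (f 0 * y ^ suc a) _ ⟩
  f 0 * y ^ suc a * G + horner (suc a) (f ∘ suc) y * G
    ≡⟨ cong₂ _+_ (cong (f 0 * y ^ suc a *_) (horner-leading b g y))
                 (horner-⋆ a b y (λ k a<k → f-vanishes (suc k) (s≤s a<k)) g-vanishes) ⟩
  f 0 * y ^ suc a * (g 0 * y ^ b + horner b (g ∘ suc) y) + H
    ≡⟨ rearrange (f 0) (g 0) (y ^ suc a) (y ^ b) (horner b (g ∘ suc) y) H ⟩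
  (f 0 * g 0 + + 0) * (y ^ suc a * y ^ b) + (f 0 * (y ^ suc a * horner b (g ∘ suc) y) + H)
    ≡⟨ cong₂ (λ t h → (f 0 * g 0 + + 0) * t + (f 0 * h + H))
             (sym (ℤₚ.^-distribˡ-+-* y (suc a) b))
             (sym (horner-trailing-zeros (suc a) b (g ∘ suc) y
                     (λ k b≤k → g-vanishes (suc k) (s≤s b≤k)))) ⟩
  (f ⋆ g) 0 * y ^ suc (a ℕ.+ b) + (f 0 * horner (suc (a ℕ.+ b)) (g ∘ suc) y + H)
    ≡⟨ cong (λ h → (f ⋆ g) 0 * y ^ suc (a ℕ.+ b) + h)
            (sym (trans (horner-+ (suc (a ℕ.+ b)) (λ k → f 0 * g (suc k)) ((f ∘ suc) ⋆ g) y)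
                        (cong (_+ H) (horner-*ˡ (f 0) (suc (a ℕ.+ b)) (g ∘ suc) y)))) ⟩
  (f ⋆ g) 0 * y ^ suc (a ℕ.+ b) + horner (suc (a ℕ.+ b)) ((f ⋆ g) ∘ suc) y
    ≡⟨ sym (horner-leading (suc (a ℕ.+ b)) (f ⋆ g) y) ⟩
  horner (suc (suc (a ℕ.+ b))) (f ⋆ g) y ∎
  where
  G : ℤ
  G = horner (suc b) g y
  H : ℤ
  H = horner (suc (a ℕ.+ b)) ((f ∘ suc) ⋆ g) y
  rearrange : ∀ f₀ g₀ s t h H →
    f₀ * s * (g₀ * t + h) + H ≡ (f₀ * g₀ + + 0) * (s * t) + (f₀ * (s * h) + H)
  rearrange = solve-∀

m≤n⇒+n-+m≡+[n∸m] : ∀ {m n} → m ≤ n → + n - + m ≡ + (n ∸ m)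
m≤n⇒+n-+m≡+[n∸m] {m} {n} m≤n = trans (ℤₚ.m-n≡m⊖n n m) (ℤₚ.⊖-≥ m≤n)

m<n⇒+m-+n<0 : ∀ {m n} → m < n → + m - + n ℤ.< + 0
m<n⇒+m-+n<0 {m} {n} m<n = subst (ℤ._< + 0) (sym +m-+n≡-[1+n∸1+m]) ℤ.-<+
  where
  +m-+n≡-[1+n∸1+m] : + m - + n ≡ -[1+ n ∸ suc m ]
  +m-+n≡-[1+n∸1+m] =
    trans (ℤₚ.m-n≡m⊖n m n) (trans (ℤₚ.⊖-< m<n) (cong (λ d → ℤ.- + d) (ℕₚ.+-∸-assoc 1 m<n)))

falling-+ : ∀ x a b → falling x (a ℕ.+ b) ≡ falling x a * falling (x - + a) b
falling-+ x a zero    =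
  trans (cong (falling x) (ℕₚ.+-identityʳ a)) (sym (ℤₚ.*-identityʳ (falling x a)))
falling-+ x a (suc b) = begin
  falling x (a ℕ.+ suc b)
    ≡⟨ cong (falling x) (ℕₚ.+-suc a b) ⟩
  falling x (a ℕ.+ b) * (x - + (a ℕ.+ b))
    ≡⟨ cong₂ (λ f s → f * (x - s)) (falling-+ x a b) (ℤₚ.pos-+ a b) ⟩
  falling x a * falling (x - + a) b * (x - (+ a + + b))
    ≡⟨ regroup x (+ a) (+ b) (falling x a) (falling (x - + a) b) ⟩
  falling x a * (falling (x - + a) b * (x - + a - + b)) ∎
  where
  regroup : ∀ x a b f g → f * g * (x - (a + b)) ≡ f * (g * (x - a - b))
  regroup = solve-∀

module Whitney (w : ℕ → ℕ → ℕ → ℤ → ℤ) (isWhitney : IsWhitney₁ w) {p : ℕ} (1≤p : 1 ≤ p) where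

  -- whitney↓ r N k = w_{p,r}(N, N - k) is the coefficient of (px + r)^(N - k).
  whitney↓ : ℕ → ℕ → ℕ → ℤ
  whitney↓ r N k = w p r N (+ N - + k)

  whitney↓-vanishesAbove : ∀ {r} N → 1 ≤ r → VanishesAbove N (whitney↓ r N)
  whitney↓-vanishesAbove {r} N 1≤r k N<k =
    proj₁ (proj₂ isWhitney) p r N (+ N - + k) 1≤p 1≤r (m<n⇒+m-+n<0 N<k)

  falling≡horner-whitney↓ : ∀ {r} N → 1 ≤ r → ∀ x →
    (+ p) ^ N * falling x N ≡ horner (suc N) (whitney↓ r N) (+ p * x + + r)
  falling≡horner-whitney↓ {r} N 1≤r x = begin
    (+ p) ^ N * falling x N
      ≡⟨ proj₁ isWhitney p r N 1≤p 1≤r x ⟩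
    sumℤ (map (λ j → w p r N (+ j) * y ^ j) (upTo (suc N)))
      ≡⟨ cong sumℤ (Listₚ.map-upTo (λ j → w p r N (+ j) * y ^ j) (suc N)) ⟩
    ∑< (suc N) (λ j → w p r N (+ j) * y ^ j)
      ≡⟨ ∑<-powers≡horner (suc N) (λ j → w p r N (+ j)) y ⟩
    horner (suc N) (λ k → w p r N (+ (N ∸ k))) y
      ≡⟨ horner-cong (suc N) y (λ k k<1+N →
           cong (w p r N) (sym (m≤n⇒+n-+m≡+[n∸m] (ℕₚ.≤-pred k<1+N)))) ⟩
    horner (suc N) (whitney↓ r N) y ∎
    where
    y : ℤ
    y = + p * x + + r

  whitney↓-empty : ∀ {r} → 1 ≤ r → whitney↓ r 0 0 ≡ + 1
  whitney↓-empty {r} 1≤r = begin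
    whitney↓ r 0 0                       ≡⟨ sym (ℤₚ.+-identityˡ (whitney↓ r 0 0)) ⟩
    + 0 + whitney↓ r 0 0                 ≡⟨ cong (_+ whitney↓ r 0 0) (sym (ℤₚ.*-zeroʳ y)) ⟩
    horner 1 (whitney↓ r 0) y            ≡⟨ sym (falling≡horner-whitney↓ 0 1≤r (+ 0)) ⟩
    + 1                                  ∎
    where
    y : ℤ
    y = + p * + 0 + + r

  1≤shifted : ∀ l {r} → 1 ≤ r → 1 ≤ l ℕ.* p ℕ.+ r
  1≤shifted l {r} 1≤r = ℕₚ.≤-trans 1≤r (ℕₚ.m≤n+m r (l ℕ.* p))

  +p≢0 : + p ≢ + 0
  +p≢0 +p≡0 = ℕₚ.<⇒≢ 1≤p (sym (ℤₚ.+-injective +p≡0))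

  whitney↓-⋆ : ∀ {r} l N → 1 ≤ r → ∀ k →
    whitney↓ r (l ℕ.+ N) k ≡ (whitney↓ r l ⋆ whitney↓ (l ℕ.* p ℕ.+ r) N) k
  whitney↓-⋆ {r} l N 1≤r =
    horner-coefficients-unique +p≢0 (l ℕ.+ N) (+ r) (whitney↓-vanishesAbove (l ℕ.+ N) 1≤r)
      (⋆-vanishesAbove (whitney↓-vanishesAbove l 1≤r) (whitney↓-vanishesAbove N 1≤r′)) agree
    where
    r′ : ℕ
    r′ = l ℕ.* p ℕ.+ r
    1≤r′ : 1 ≤ r′
    1≤r′ = 1≤shifted l 1≤r
    P : ℤ
    P = + p
    shifted-point : ∀ x → P * (x - + l) + + r′ ≡ P * x + + r
    shifted-point x = begin
      P * (x - + l) + + r′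
        ≡⟨ cong (λ s → P * (x - + l) + s) (trans (ℤₚ.pos-+ (l ℕ.* p) r) (cong (_+ + r) (ℤₚ.pos-* l p))) ⟩
      P * (x - + l) + (+ l * P + + r)
        ≡⟨ cancel P x (+ l) (+ r) ⟩
      P * x + + r ∎
      where
      cancel : ∀ P x l r → P * (x - l) + (l * P + r) ≡ P * x + r
      cancel = solve-∀
    agree : ∀ i → horner (suc (l ℕ.+ N)) (whitney↓ r (l ℕ.+ N)) (P * + i + + r)
                ≡ horner (suc (l ℕ.+ N)) (whitney↓ r l ⋆ whitney↓ r′ N) (P * + i + + r)
    agree i = begin
      horner (suc (l ℕ.+ N)) (whitney↓ r (l ℕ.+ N)) y
        ≡⟨ sym (falling≡horner-whitney↓ (l ℕ.+ N) 1≤r x) ⟩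
      P ^ (l ℕ.+ N) * falling x (l ℕ.+ N)
        ≡⟨ cong₂ _*_ (ℤₚ.^-distribˡ-+-* P l N) (falling-+ x l N) ⟩
      P ^ l * P ^ N * (falling x l * falling (x - + l) N)
        ≡⟨ interchange (P ^ l) (P ^ N) (falling x l) (falling (x - + l) N) ⟩
      P ^ l * falling x l * (P ^ N * falling (x - + l) N)
        ≡⟨ cong₂ _*_ (falling≡horner-whitney↓ l 1≤r x) (falling≡horner-whitney↓ N 1≤r′ (x - + l)) ⟩
      horner (suc l) (whitney↓ r l) y * horner (suc N) (whitney↓ r′ N) (P * (x - + l) + + r′)
        ≡⟨ cong (horner (suc l) (whitney↓ r l) y *_) (cong (horner (suc N) (whitney↓ r′ N)) (shifted-point x)) ⟩
      horner (suc l) (whitney↓ r l) y * horner (suc N) (whitney↓ r′ N) y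
        ≡⟨ horner-⋆ l N y (whitney↓-vanishesAbove l 1≤r) (whitney↓-vanishesAbove N 1≤r′) ⟩
      horner (suc (l ℕ.+ N)) (whitney↓ r l ⋆ whitney↓ r′ N) y ∎
      where
      x : ℤ
      x = + i
      y : ℤ
      y = P * x + + r

  factor : ℕ → ℕ → ℕ × ℕ → ℤ
  factor r a λk = w p (a ℕ.* p ℕ.+ r) (proj₁ λk) (+ proj₁ λk - + proj₂ λk)

  productℤ : ∀ {m} → Vec ℤ m → ℤ
  productℤ = Vec.foldr (λ _ → ℤ) _*_ (+ 1)

  productℤ-factor-shift : ∀ {m} r l (as : Vec ℕ m) λks →
    productℤ (Vec.zipWith (factor r) (Vec.map (l ℕ.+_) as) λks)
      ≡ productℤ (Vec.zipWith (factor (l ℕ.* p ℕ.+ r)) as λks)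
  productℤ-factor-shift r l []       []         = refl
  productℤ-factor-shift r l (a ∷ as) (λk ∷ λks) =
    cong₂ _*_ (cong (λ s → w p s (proj₁ λk) (+ proj₁ λk - + proj₂ λk)) (regroup l a p r))
              (productℤ-factor-shift r l as λks)
    where
    regroup : ∀ l a p r → (l ℕ.+ a) ℕ.* p ℕ.+ r ≡ a ℕ.* p ℕ.+ (l ℕ.* p ℕ.+ r)
    regroup = solve-∀ℕ

  whitneyProduct-∷ : ∀ {m} r l i (λs : Vec ℕ m) ks →
    whitneyProduct w p r (l ∷ λs) (i ∷ ks) ≡ whitney↓ r l i * whitneyProduct w p (l ℕ.* p ℕ.+ r) λs ks
  whitneyProduct-∷ r l i λs ks =
    cong (whitney↓ r l i *_) (productℤ-factor-shift r l (prefixSums λs) (Vec.zip λs ks))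

  compositionSum : ∀ {m} → ℕ → Vec ℕ m → ℕ → ℤ
  compositionSum {m} r λs k = sumℤ (map (whitneyProduct w p r λs) (tuplesSum m k))

  compositionSum-∷ : ∀ {m} r l (λs : Vec ℕ m) k →
    compositionSum r (l ∷ λs) k ≡ (whitney↓ r l ⋆ compositionSum (l ℕ.* p ℕ.+ r) λs) k
  compositionSum-∷ {m} r l λs k = begin
    sumℤ (map product (concatMap tuplesStartingWith (upTo (suc k))))
      ≡⟨ cong sumℤ (Listₚ.map-concatMap product tuplesStartingWith (upTo (suc k))) ⟩
    sumℤ (concatMap (map product ∘ tuplesStartingWith) (upTo (suc k)))
      ≡⟨ sumℤ-concatMap (map product ∘ tuplesStartingWith) (upTo (suc k)) ⟩
    sumℤ (map (sumℤ ∘ map product ∘ tuplesStartingWith) (upTo (suc k)))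
      ≡⟨ cong sumℤ (Listₚ.map-upTo (sumℤ ∘ map product ∘ tuplesStartingWith) (suc k)) ⟩
    ∑< (suc k) (sumℤ ∘ map product ∘ tuplesStartingWith)
      ≡⟨ ∑<-cong (suc k) (λ i _ → first-part-fixed i) ⟩
    (whitney↓ r l ⋆ compositionSum r′ λs) k ∎
    where
    r′ : ℕ
    r′ = l ℕ.* p ℕ.+ r
    product : Vec ℕ (suc m) → ℤ
    product = whitneyProduct w p r (l ∷ λs)
    tuples : ℕ → List (Vec ℕ m)
    tuples i = tuplesSum m (k ∸ i)
    tuplesStartingWith : ℕ → List (Vec ℕ (suc m))
    tuplesStartingWith i = map (i ∷_) (tuples i)
    first-part-fixed : ∀ i →
      sumℤ (map product (tuplesStartingWith i)) ≡ whitney↓ r l i * compositionSum r′ λs (k ∸ i)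
    first-part-fixed i = begin
      sumℤ (map product (map (i ∷_) (tuples i)))
        ≡⟨ cong sumℤ (sym (Listₚ.map-∘ (tuples i))) ⟩
      sumℤ (map (λ ks → product (i ∷ ks)) (tuples i))
        ≡⟨ cong sumℤ (Listₚ.map-cong (whitneyProduct-∷ r l i λs) (tuples i)) ⟩
      sumℤ (map (λ ks → c * whitneyProduct w p r′ λs ks) (tuples i))
        ≡⟨ cong sumℤ (Listₚ.map-∘ (tuples i)) ⟩
      sumℤ (map (c *_) (map (whitneyProduct w p r′ λs) (tuples i)))
        ≡⟨ sumℤ-map-*ˡ c (map (whitneyProduct w p r′ λs) (tuples i)) ⟩
      c * compositionSum r′ λs (k ∸ i) ∎
      where
      c : ℤ
      c = whitney↓ r l i

  whitney↓-composition : ∀ {m} (λs : Vec ℕ m) {r} → 1 ≤ r → ∀ k →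
    whitney↓ r (sum λs) k ≡ compositionSum r λs k
  whitney↓-composition []       1≤r zero    = whitney↓-empty 1≤r
  whitney↓-composition []       1≤r (suc k) = whitney↓-vanishesAbove 0 1≤r (suc k) (s≤s z≤n)
  whitney↓-composition (l ∷ λs) {r} 1≤r k = begin
    whitney↓ r (l ℕ.+ sum λs) k
      ≡⟨ whitney↓-⋆ l (sum λs) 1≤r k ⟩
    (whitney↓ r l ⋆ whitney↓ (l ℕ.* p ℕ.+ r) (sum λs)) k
      ≡⟨ ⋆-congʳ (whitney↓ r l) (whitney↓-composition λs (1≤shifted l 1≤r)) k ⟩
    (whitney↓ r l ⋆ compositionSum (l ℕ.* p ℕ.+ r) λs) k
      ≡⟨ sym (compositionSum-∷ r l λs k) ⟩
    compositionSum r (l ∷ λs) k ∎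

-- The identity holds for every k and m and for sequences with zero parts as well.
corollary3p1 : (w : ℕ → ℕ → ℕ → ℤ → ℤ) → IsWhitney₁ w →
    (k m n p r : ℕ) → 1 ≤ k → 1 ≤ m → 1 ≤ n → 1 ≤ p → 1 ≤ r →
    (λs : Vec ℕ m) → AllPositive λs → sum λs ≡ n →
    w p r n (+ n - + k)
      ≡ sumℤ (map (λ ks → whitneyProduct w p r λs ks) (tuplesSum m k))
corollary3p1 w isWhitney k m n p r _ _ _ 1≤p 1≤r λs _ refl =
  Whitney.whitney↓-composition w isWhitney 1≤p λs 1≤r k
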